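{- Let $G$ be a finite simple graph and let $F$ be a minimal fort of $G$. Then for every vertex $f\in F$, if the vertices of $V(G)\setminus F$ together with $f$ are initially colored and the color-change rule is applied repeatedly, eventually every vertex of $G$ becomes colored.
   Context: A fort of $G$ is a nonempty set $F\subseteq V(G)$ such that every vertex not in $F$ is adjacent to either zero or at least two vertices of $F$; it is minimal if no proper subset is a fort. Zero forcing: some vertices are colored, the rest uncolored; the color-change rule says that if a colored vertex has exactly one uncolored neighbor, that neighbor becomes colored. -}

module Defs where

open import Data.Nat using (ℕ)
open import Data.Bool using (Bool; true; false)
open import Data.Fin using (Fin)
open import Data.Fin.Subset using (Subset; _∈_; _∉_; _⊆_; _∩_; ∣_∣; Nonempty)
open import Data.Vec using (tabulate)
open import Relation.Binary.PropositionalEquality using (_≡_; _≢_)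
open import Data.Product using (_×_)

record Graph (n : ℕ) : Set where
  field
    adj     : Fin n → Fin n → Bool
    symmetric   : ∀ u v → adj u v ≡ adj v u
    irreflexive : ∀ v → adj v v ≡ false

open Graph public

Adjacent : ∀ {n} → Graph n → Fin n → Fin n → Set
Adjacent G u v = adj G u v ≡ true

nbhd : ∀ {n} → Graph n → Fin n → Subset n
nbhd G v = tabulate (adj G v)

IsFort : ∀ {n} → Graph n → Subset n → Set
IsFort G F = Nonempty F × (∀ v → v ∉ F → ∣ nbhd G v ∩ F ∣ ≢ 1)

IsMinimalFort : ∀ {n} → Graph n → Subset n → Set
IsMinimalFort G F = IsFort G F × (∀ F′ → F′ ⊆ F → IsFort G F′ → F′ ≡ F)

-- Vertices eventually colored by repeatedly applying the color-change rule
-- starting from the initially colored set S: a colored vertex u with exactly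
-- one uncolored neighbour v colors v.
data Colored {n} (G : Graph n) (S : Subset n) : Fin n → Set where
  initial : ∀ {v} → v ∈ S → Colored G S v
  force   : ∀ {u v} → Colored G S u → Adjacent G u v →
            (∀ w → Adjacent G u w → w ≢ v → Colored G S w) →
            Colored G S v

{-# OPTIONS --safe #-}
-- Call U a set of possibly uncolored vertices if everything outside U is
-- eventually colored.  If some vertex u outside U has exactly one neighbour w
-- in U, then u forces w and U - w is again such a set; otherwise U is empty or,
-- by definition, a fort.  Starting from U = F - f, shrinking must therefore end
-- with the empty set, since a fort inside F - f would contradict minimality of F.
module Submission where

open import Defs
open import Data.Nat using (_≤_; _<_; _≟_)
open import Data.Nat.Properties using (<-irrefl; 1+n≢0; module ≤-Reasoning)
open import Data.Nat.Induction using (<-wellFounded)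
open import Data.Fin using (Fin)
import Data.Fin.Properties as Fin
open import Data.Fin.Subset
  using (Subset; inside; outside; _∈_; _∉_; _⊆_; _∩_; _∪_; _─_; _-_; ∁; ⁅_⁆; ⊥; ∣_∣; Nonempty)
open import Data.Fin.Subset.Properties
open import Data.Vec using (_∷_; here; there)
open import Data.Vec.Properties using ([]=⇒lookup; lookup⇒[]=; lookup∘tabulate)
open import Data.Product using (∃; _×_; _,_; proj₁; proj₂)
open import Data.Sum using (_⊎_; inj₁; inj₂)
import Data.Sum as Sum
open import Induction.WellFounded using (Acc; acc)
open import Relation.Nullary using (¬_; yes; no; Dec; contradiction)
open import Relation.Nullary.Decidable using (_×-dec_; ¬?)
open import Relation.Binary.PropositionalEquality using (_≡_; _≢_; refl; sym; trans; cong; subst; module ≡-Reasoning)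

x∈p─q⇒x∉q : ∀ {n} {p q : Subset n} {x : Fin n} → x ∈ p ─ q → x ∉ q
x∈p─q⇒x∉q {p = _ ∷ _} {inside  ∷ _} () here
x∈p─q⇒x∉q {p = _ ∷ _} {outside ∷ _} here ()
x∈p─q⇒x∉q {p = _ ∷ _} {_       ∷ _} (there x∈p─q) (there x∈q) = x∈p─q⇒x∉q x∈p─q x∈q

x∈p⇒0<∣p∣ : ∀ {n} {p : Subset n} {x : Fin n} → x ∈ p → 0 < ∣ p ∣
x∈p⇒0<∣p∣ {p = p} {x} x∈p = subst (_≤ ∣ p ∣) (∣⁅x⁆∣≡1 x) (p⊆q⇒∣p∣≤∣q∣ ⁅x⁆⊆p)
  where
  ⁅x⁆⊆p : ⁅ x ⁆ ⊆ p
  ⁅x⁆⊆p y∈⁅x⁆ = subst (_∈ p) (sym (x∈⁅y⁆⇒x≡y x y∈⁅x⁆)) x∈p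

∣p∣≡1⇒Nonempty : ∀ {n} {p : Subset n} → ∣ p ∣ ≡ 1 → Nonempty p
∣p∣≡1⇒Nonempty {n} {p} ∣p∣≡1 with nonempty? p
... | yes p-nonempty = p-nonempty
... | no  p-empty    = contradiction (begin
  1         ≡⟨ sym ∣p∣≡1 ⟩
  ∣ p ∣     ≡⟨ cong ∣_∣ (Empty-unique p-empty) ⟩
  ∣ ⊥ {n} ∣ ≡⟨ ∣⊥∣≡0 n ⟩
  0         ∎) 1+n≢0
  where open ≡-Reasoning

∣p∣≡1⇒x≡y : ∀ {n} {p : Subset n} {x y : Fin n} → ∣ p ∣ ≡ 1 → x ∈ p → y ∈ p → x ≡ y
∣p∣≡1⇒x≡y {p = p} {x} {y} ∣p∣≡1 x∈p y∈p with y Fin.≟ x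
... | yes y≡x = sym y≡x
... | no  y≢x = contradiction (begin-strict
  1          ≤⟨ x∈p⇒0<∣p∣ (x∈p∧x≢y⇒x∈p-y y∈p y≢x) ⟩
  ∣ p - x ∣  <⟨ x∈p⇒∣p-x∣<∣p∣ x∈p ⟩
  ∣ p ∣      ≡⟨ ∣p∣≡1 ⟩
  1          ∎) (<-irrefl refl)
  where open ≤-Reasoning

module _ {n} (G : Graph n) where

  adjacent⇒∈nbhd : ∀ {u v} → Adjacent G u v → v ∈ nbhd G u
  adjacent⇒∈nbhd {u} {v} u~v = lookup⇒[]= v _ (trans (lookup∘tabulate (adj G u) v) u~v)

  ∈nbhd⇒adjacent : ∀ {u v} → v ∈ nbhd G u → Adjacent G u v
  ∈nbhd⇒adjacent {u} {v} v∈N = trans (sym (lookup∘tabulate (adj G u) v)) ([]=⇒lookup v∈N)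

  HasSoleNeighbourIn : Subset n → Fin n → Set
  HasSoleNeighbourIn U u = u ∉ U × ∣ nbhd G u ∩ U ∣ ≡ 1

  ¬HasSoleNeighbourIn⇒IsFort : ∀ {U} → Nonempty U → ¬ ∃ (HasSoleNeighbourIn U) → IsFort G U
  ¬HasSoleNeighbourIn⇒IsFort U-nonempty none = U-nonempty , λ u u∉U one → none (u , u∉U , one)

  hasSoleNeighbourIn? : ∀ U → Dec (∃ (HasSoleNeighbourIn U))
  hasSoleNeighbourIn? U = Fin.any? λ u → ¬? (u ∈? U) ×-dec (∣ nbhd G u ∩ U ∣ ≟ 1)

module _ {n} (G : Graph n) (S : Subset n) where

  ColoredOutside : Subset n → Set
  ColoredOutside U = ∀ v → v ∉ U → Colored G S v

  soleNeighbour-colored : ∀ {U u w} → ColoredOutside U → HasSoleNeighbourIn G U u →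
                          w ∈ nbhd G u ∩ U → Colored G S w
  soleNeighbour-colored {U} {u} {w} col (u∉U , one) w∈N∩U =
    force (col u u∉U) (∈nbhd⇒adjacent G (proj₁ (x∈p∩q⁻ _ _ w∈N∩U))) others
    where
    others : ∀ x → Adjacent G u x → x ≢ w → Colored G S x
    others x u~x x≢w with x ∈? U
    ... | no  x∉U = col x x∉U
    ... | yes x∈U = contradiction (∣p∣≡1⇒x≡y one (x∈p∩q⁺ (adjacent⇒∈nbhd G u~x , x∈U)) w∈N∩U) x≢w

  ColoredOutside-remove : ∀ {U w} → ColoredOutside U → Colored G S w → ColoredOutside (U - w)
  ColoredOutside-remove {U} {w} col w-colored v v∉U-w with v Fin.≟ w
  ... | yes refl = w-colored
  ... | no  v≢w  = col v (λ v∈U → v∉U-w (x∈p∧x≢y⇒x∈p-y v∈U v≢w))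

  colored-or-fort⊆ : ∀ U → ColoredOutside U →
                     (∀ v → Colored G S v) ⊎ ∃ λ F → F ⊆ U × IsFort G F
  colored-or-fort⊆ U = go (<-wellFounded ∣ U ∣)
    where
    go : ∀ {U} → Acc _<_ ∣ U ∣ → ColoredOutside U →
         (∀ v → Colored G S v) ⊎ ∃ λ F → F ⊆ U × IsFort G F
    go {U} (acc smaller) col with hasSoleNeighbourIn? G U | nonempty? U
    ... | yes (u , sole) | _ with ∣p∣≡1⇒Nonempty (proj₂ sole)
    ...   | w , w∈N∩U = Sum.map₂ shrink (go (smaller (x∈p⇒∣p-x∣<∣p∣ w∈U))
                                             (ColoredOutside-remove col (soleNeighbour-colored col sole w∈N∩U)))
      where
      w∈U : w ∈ U
      w∈U = proj₂ (x∈p∩q⁻ _ _ w∈N∩U)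
      shrink : (∃ λ F → F ⊆ U - w × IsFort G F) → ∃ λ F → F ⊆ U × IsFort G F
      shrink (F , F⊆U-w , fort) = F , ⊆-trans F⊆U-w (p─q⊆p U ⁅ w ⁆) , fort
    go {U} _ col | no none | yes U-nonempty =
      inj₂ (U , ⊆-refl , ¬HasSoleNeighbourIn⇒IsFort G U-nonempty none)
    go {U} _ col | no _    | no  U-empty    = inj₁ λ v → col v λ v∈U → U-empty (v , v∈U)

initially-colored-outside : ∀ {n} (G : Graph n) (F : Subset n) f →
                            ColoredOutside G (∁ F ∪ ⁅ f ⁆) (F - f)
initially-colored-outside G F f v v∉F-f with v ∈? F | v Fin.≟ f
... | no  v∉F | _        = initial (x∈p∪q⁺ (inj₁ (x∉p⇒x∈∁p v∉F)))
... | yes _   | yes refl = initial (x∈p∪q⁺ (inj₂ (x∈⁅x⁆ v)))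
... | yes v∈F | no  v≢f  = contradiction (x∈p∧x≢y⇒x∈p-y v∈F v≢f) v∉F-f

¬IsFort⊆minimalFort-x : ∀ {n} (G : Graph n) {F F′ : Subset n} {x} →
                        IsMinimalFort G F → x ∈ F → F′ ⊆ F - x → ¬ IsFort G F′
¬IsFort⊆minimalFort-x G {F} {F′} {x} (_ , minimal) x∈F F′⊆F-x fort =
  x∈p─q⇒x∉q (F′⊆F-x x∈F′) (x∈⁅x⁆ x)
  where
  x∈F′ : x ∈ F′
  x∈F′ = subst (x ∈_) (sym (minimal F′ (⊆-trans F′⊆F-x (p─q⊆p F ⁅ x ⁆)) fort)) x∈F

proposition2 : ∀ {n} (G : Graph n) (F : Subset n) → IsMinimalFort G F →
    ∀ f → f ∈ F → ∀ v → Colored G (∁ F ∪ ⁅ f ⁆) v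
proposition2 G F minimal f f∈F
  with colored-or-fort⊆ G (∁ F ∪ ⁅ f ⁆) (F - f) (initially-colored-outside G F f)
... | inj₁ all-colored          = all-colored
... | inj₂ (F′ , F′⊆F-f , fort) = contradiction fort (¬IsFort⊆minimalFort-x G minimal f∈F F′⊆F-f)
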